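{- Let $T$ be a binary phylogenetic tree (viewed as an undirected graph) and let $(Y,Z)$ be a non-trivial bipartition of the labels of $T$ (i.e. $Y,Z\neq\emptyset$). Then there exists a splitting core $C$ for $T$ with respect to $(Y,Z)$ such that $\sum_{K\in C} 2^{ -|K|}\le \frac12$.
   Context: A binary phylogenetic tree on a label set is either an unrooted one (a tree whose leaves are bijectively labelled and whose internal vertices have degree 3) or a rooted one (internal nodes have indegree 1 and outdegree 2, except a root of indegree 0 and outdegree 2); here edges are treated as undirected. A cut is a set $K\subseteq E(T)$. A cut $K$ splits $T$ (with respect to $(Y,Z)$) if no connected component of $T\setminus K$ contains both a leaf labelled from $Y$ and a leaf labelled from $Z$. A cut $K_1$ refines a cut $K_2$ if any two labels connected in $T\setminus K_1$ are also connected in $T\setminus K_2$. A set $C=\{K_1,\dots,K_n\}$ of non-empty cuts is a splitting core if every cut $K$ that splits $T$ refines some $K_i\in C$. -}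

module Defs where

open import Data.Nat using (ℕ; zero; suc; _+_; _*_; _∸_; _^_; _≤_)
open import Data.Fin using (Fin; _≟_)
open import Data.Fin.Subset using (Subset; _∈_; _∉_; ∣_∣; Nonempty; ⁅_⁆)
import Data.Fin.Subset
open import Data.List using (List; length; filter; map; allFin)
open import Data.Nat.ListAction using (sum)
open import Data.List.Relation.Unary.Any using (Any)
open import Data.List.Relation.Unary.All using (All)
open import Data.List.Relation.Unary.Unique.Propositional using (Unique)
open import Data.Product using (Σ; ∃; _×_; _,_; proj₁; proj₂)
open import Data.Sum using (_⊎_)
open import Relation.Nullary using (¬_; Dec)
open import Relation.Nullary.Decidable using (_⊎-dec_)
open import Relation.Binary.PropositionalEquality using (_≡_)
open import Function using (_⇔_)

-- A finite (multi)graph with vertex set Fin n and edge set Fin m;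
-- edge e joins the two vertices  proj₁ (ends e)  and  proj₂ (ends e)
-- (edges are undirected).
record LGraph (n m k : ℕ) : Set where
  field
    ends : Fin m → Fin n × Fin n
    lab  : Fin k → Fin n
open LGraph public

module _ {n m k : ℕ} (T : LGraph n m k) where

  Joins : Fin m → Fin n → Fin n → Set
  Joins e u w = (proj₁ (ends T e) ≡ u × proj₂ (ends T e) ≡ w)
              ⊎ (proj₁ (ends T e) ≡ w × proj₂ (ends T e) ≡ u)

  data Conn (K : Subset m) : Fin n → Fin n → Set where
    here : ∀ {u} → Conn K u u
    step : ∀ {u w v} (e : Fin m) → e ∉ K → Joins e u w → Conn K w v → Conn K u v

  ∅cut : Subset m
  ∅cut = Data.Fin.Subset.⊥

  Connected : Set
  Connected = ∀ u v → Conn ∅cut u v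

  -- acyclic: every edge is a bridge, i.e. its two ends are not connected
  -- once that edge is removed (this also excludes loops and parallel edges)
  Acyclic : Set
  Acyclic = ∀ e → ¬ Conn ⁅ e ⁆ (proj₁ (ends T e)) (proj₂ (ends T e))

  IsTree : Set
  IsTree = Connected × Acyclic

  incident? : (v : Fin n) (e : Fin m) → Dec (proj₁ (ends T e) ≡ v ⊎ proj₂ (ends T e) ≡ v)
  incident? v e = (proj₁ (ends T e) ≟ v) ⊎-dec (proj₂ (ends T e) ≟ v)

  deg : Fin n → ℕ
  deg v = length (filter (incident? v) (allFin m))

  Labelled : Fin n → Set
  Labelled v = ∃ λ a → lab T a ≡ v

  LeavesBijLabelled : Set
  LeavesBijLabelled = (∀ a b → lab T a ≡ lab T b → a ≡ b)
                    × (∀ v → Labelled v ⇔ deg v ≤ 1)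

  IsUnrootedBinaryPhyloTree : Set
  IsUnrootedBinaryPhyloTree = IsTree × LeavesBijLabelled
    × (∀ v → ¬ Labelled v → deg v ≡ 3)

  -- rooted binary phylogenetic tree (edges treated as undirected): a root of
  -- degree 2 (indegree 0, outdegree 2), all other internal vertices of
  -- degree 3 (indegree 1, outdegree 2)
  IsRootedBinaryPhyloTree : Set
  IsRootedBinaryPhyloTree = IsTree × LeavesBijLabelled
    × Σ (Fin n) (λ r → ¬ Labelled r × deg r ≡ 2
        × (∀ v → ¬ Labelled v → ¬ v ≡ r → deg v ≡ 3))

  IsBinaryPhyloTree : Set
  IsBinaryPhyloTree = IsUnrootedBinaryPhyloTree ⊎ IsRootedBinaryPhyloTree

  LConn : Subset m → Fin k → Fin k → Set
  LConn K a b = Conn K (lab T a) (lab T b)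

  -- K splits T w.r.t. (Y, Z), where Z is the complement of Y in Fin k
  Splits : Subset k → Subset m → Set
  Splits Y K = ∀ a b → a ∈ Y → b ∉ Y → ¬ LConn K a b

  Refines : Subset m → Subset m → Set
  Refines K₁ K₂ = ∀ a b → LConn K₁ a b → LConn K₂ a b

  -- C (a duplicate-free list of cuts, i.e. a finite set) is a splitting core
  IsSplittingCore : Subset k → List (Subset m) → Set
  IsSplittingCore Y C = Unique C
    × All Nonempty C
    × (∀ K → Splits Y K → Any (Refines K) C)

-- Σ_{K ∈ C} 2^{-|K|}  scaled by 2^m (m = number of edges ≥ |K|):
-- returns Σ_{K ∈ C} 2^{m ∸ |K|}, an exact natural number.
scaledWeight : {m : ℕ} → List (Subset m) → ℕ
scaledWeight {m} C = sum (map (λ K → 2 ^ (m ∸ ∣ K ∣)) C)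

{-# OPTIONS --safe #-}
module Submission where

-- Colour the labels by membership in Y and prove, by induction on a set A of labels
-- carrying two colours, that A has a core of weight at most 1/2 whose cuts only use
-- edges between labels of A. Walking inwards from a leaf while the labels behind the
-- current edge still carry two colours, one reaches a vertex v with edges c₁, c₂
-- behind which all labels of A have one colour, different for c₁ and c₂. A splitting
-- cut K must then cut off from v all labels behind c₁ or all behind c₂; in the first
-- case K refines K′ ∪ {c₁} for some cut K′ of a core for the labels on v's side of c₁.
-- Extending the two cores by c₁ resp. c₂ halves their weights, giving 1/4 + 1/4.
-- If the labels on v's side of some cᵢ are monochromatic, {cᵢ} alone is a core.

open import Defs
open import Data.Nat using (ℕ; _*_; _^_; _≤_)
open import Data.Fin.Subset using (Subset; Nonempty; ∁)
open import Data.List using (List)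
open import Data.Product using (Σ; _×_)

import Data.Bool as Bool
open import Data.Empty using (⊥-elim)
open import Data.Fin using (Fin; _≟_)
open import Data.Fin.Properties using (any?; all?)
open import Data.Fin.Subset using (_∈_; _∉_; _⊆_; _⊂_; _∪_; _∩_; _-_; ⁅_⁆; ⊤; Lift; ∣_∣)
open import Data.Fin.Subset.Properties
  using ( _∈?_; x∈p∪q⁺; x∈p∪q⁻; p⊆p∪q; q⊆p∪q; x∈p∩q⁺; x∈p∩q⁻; p∩q⊆p; p─q⊆p
        ; x∈⁅x⁆; x∈⁅y⁆⇒x≡y; x≢y⇒x∉⁅y⁆; x∉⁅y⁆⇒x≢y; ∣⁅x⁆∣≡1; x∈p⇒p-x⊂p; x∈p∧x≢y⇒x∈p-y
        ; ∈⊤; x∈∁p⇒x∉p; nonempty?; p⊂q⇒∣p∣<∣q∣; ∣p∣≤n )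
open import Data.Fin.Subset.Induction using (Acc; acc; ⊂-wellFounded)
open import Data.List using ([]; _∷_; _++_; map; length; deduplicate)
open import Data.List.Properties using (map-++)
open import Data.List.Membership.Propositional using (lose) renaming (_∈_ to _∈ₗ_)
open import Data.List.Membership.Propositional.Properties
  using (∈-map⁺; ∈-++⁺ˡ; ∈-++⁺ʳ; ∈-filter⁺; ∈-allFin; ∈-deduplicate⁺)
open import Data.List.Relation.Unary.All as All using (All; []; _∷_)
import Data.List.Relation.Unary.All.Properties as All
open import Data.List.Relation.Unary.Any using (Any; here)
open import Data.List.Relation.Binary.Sublist.Propositional using ([]; _∷_; _∷ʳ_) renaming (_⊆_ to _⊑_)
open import Data.List.Relation.Binary.Sublist.Heterogeneous.Properties using (filter-Sublist)
open import Data.List.Relation.Unary.Unique.DecPropositional.Properties using (deduplicate-!)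
open import Data.Nat using (suc; _+_; _∸_; _<_; z≤n; s≤s)
open import Data.Nat.ListAction using (sum)
open import Data.Nat.ListAction.Properties using (sum-++)
open import Data.Nat.Properties
  using ( ≤-refl; ≤-reflexive; ≤-trans; *-comm; +-mono-≤; +-monoʳ-≤; *-monoʳ-≤; *-cancelˡ-≤; *-distribˡ-+; *-assoc
        ; +-identityʳ; m≤n+m; ^-monoʳ-≤; ∸-monoʳ-<; module ≤-Reasoning )
open import Data.Product using (∃; ∃₂; ∃-syntax; _,_; proj₁; proj₂)
import Data.Product as Product
open import Data.Sum using (_⊎_; inj₁; inj₂; [_,_]; swap)
open import Data.Vec using (tabulate)
open import Data.Vec.Properties using (lookup∘tabulate; lookup⇒[]=; []=⇒lookup; ≡-dec)
open import Function using (_∘_; id; Equivalence)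
open import Level using (0ℓ)
open import Relation.Binary.Definitions using (DecidableEquality)
open import Relation.Binary.PropositionalEquality using (_≡_; _≢_; refl; sym; trans; cong; subst)
open import Relation.Nullary using (¬_; Dec; yes; no; does; proof; ¬?)
open import Relation.Nullary.Reflects using (Reflects; invert)
open import Relation.Nullary.Decidable using (_×-dec_; _→-dec_; dec-true; dec-false; decidable-stable; map′)
open import Relation.Unary using (Pred; Decidable; U) renaming (_∪_ to _∪ᵘ_)

module _ {n p} {P : Pred (Fin n) p} (P? : Decidable P) where

  select : Subset n
  select = tabulate (λ x → does (P? x))

  ∈-select⁺ : ∀ {x} → P x → x ∈ select
  ∈-select⁺ {x} px = lookup⇒[]= x select (trans (lookup∘tabulate _ x) (dec-true (P? x) px))

  ∈-select⁻ : ∀ {x} → x ∈ select → P x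
  ∈-select⁻ {x} x∈ =
    invert (subst (Reflects (P x)) (trans (sym (lookup∘tabulate _ x)) ([]=⇒lookup x∈)) (proof (P? x)))

∈-length≤1 : ∀ {A : Set} {xs : List A} {x y} → length xs ≤ 1 → x ∈ₗ xs → y ∈ₗ xs → x ≡ y
∈-length≤1 {xs = _ ∷ []}    _         (here refl) (here refl) = refl
∈-length≤1 {xs = _ ∷ _ ∷ _} (s≤s ())  _           _

deduplicate-⊑ : ∀ {A : Set} (_≟_ : DecidableEquality A) xs → deduplicate _≟_ xs ⊑ xs
deduplicate-⊑ _≟_ []       = []
deduplicate-⊑ _≟_ (x ∷ xs) = refl ∷ filter-Sublist _ (deduplicate-⊑ _≟_ xs)

+-≤-halves : ∀ {a b c} → 2 * a ≤ c → 2 * b ≤ c → a + b ≤ c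
+-≤-halves {a} {b} {c} 2a≤c 2b≤c = *-cancelˡ-≤ 2 (begin
  2 * (a + b)    ≡⟨ *-distribˡ-+ 2 a b ⟩
  2 * a + 2 * b  ≤⟨ +-mono-≤ 2a≤c 2b≤c ⟩
  c + c          ≡⟨ cong (c +_) (sym (+-identityʳ c)) ⟩
  2 * c          ∎)
  where open ≤-Reasoning

scaledWeight-++ : ∀ {m} (Ks Ks′ : List (Subset m)) →
                  scaledWeight (Ks ++ Ks′) ≡ scaledWeight Ks + scaledWeight Ks′
scaledWeight-++ {m} Ks Ks′ = trans (cong sum (map-++ weight Ks Ks′)) (sum-++ (map weight Ks) (map weight Ks′))
  where weight = λ (K : Subset m) → 2 ^ (m ∸ ∣ K ∣)

scaledWeight-⊑ : ∀ {m} {Ks Ks′ : List (Subset m)} → Ks ⊑ Ks′ → scaledWeight Ks ≤ scaledWeight Ks′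
scaledWeight-⊑ []              = ≤-refl
scaledWeight-⊑ {m} (K ∷ʳ Ks⊑Ks′) = ≤-trans (scaledWeight-⊑ Ks⊑Ks′) (m≤n+m _ (2 ^ (m ∸ ∣ K ∣)))
scaledWeight-⊑ {m} (_∷_ {x = K} refl Ks⊑Ks′) = +-monoʳ-≤ (2 ^ (m ∸ ∣ K ∣)) (scaledWeight-⊑ Ks⊑Ks′)

scaledWeight-⁅⁆ : ∀ {m} (c : Fin m) → 2 * scaledWeight (⁅ c ⁆ ∷ []) ≡ 2 ^ m
scaledWeight-⁅⁆ {suc m} c rewrite ∣⁅x⁆∣≡1 c = cong (2 *_) (+-identityʳ (2 ^ m))

scaledWeight-∪-fresh : ∀ {m} {c : Fin m} {Ks} → All (c ∉_) Ks →
                       2 * scaledWeight (map (_∪ ⁅ c ⁆) Ks) ≤ scaledWeight Ks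
scaledWeight-∪-fresh [] = z≤n
scaledWeight-∪-fresh {m} {c} {K ∷ Ks} (c∉K ∷ fresh) = begin
  2 * (2 ^ (m ∸ ∣ K ∪ ⁅ c ⁆ ∣) + scaledWeight (map (_∪ ⁅ c ⁆) Ks))
    ≡⟨ *-distribˡ-+ 2 (2 ^ (m ∸ ∣ K ∪ ⁅ c ⁆ ∣)) _ ⟩
  2 ^ suc (m ∸ ∣ K ∪ ⁅ c ⁆ ∣) + 2 * scaledWeight (map (_∪ ⁅ c ⁆) Ks)
    ≤⟨ +-mono-≤ (^-monoʳ-≤ 2 (∸-monoʳ-< ∣K∣<∣K∪c∣ (∣p∣≤n (K ∪ ⁅ c ⁆)))) (scaledWeight-∪-fresh fresh) ⟩
  2 ^ (m ∸ ∣ K ∣) + scaledWeight Ks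
    ∎
  where
  open ≤-Reasoning
  ∣K∣<∣K∪c∣ : ∣ K ∣ < ∣ K ∪ ⁅ c ⁆ ∣
  ∣K∣<∣K∪c∣ = p⊂q⇒∣p∣<∣q∣ (p⊆p∪q _ , c , x∈p∪q⁺ (inj₂ (x∈⁅x⁆ c)) , c∉K)

module Walks {n m k : ℕ} (T : LGraph n m k) where

  Incident : Fin m → Fin n → Set
  Incident e v = proj₁ (ends T e) ≡ v ⊎ proj₂ (ends T e) ≡ v

  private variable
    K K′ : Subset m
    c e f : Fin m
    s t u v w x y : Fin n

  ends-joined : ∀ e → Joins T e (proj₁ (ends T e)) (proj₂ (ends T e))
  ends-joined e = inj₁ (refl , refl)

  Joins-sym : Joins T e u w → Joins T e w u
  Joins-sym = swap

  Joins-incident : Joins T e u w → Incident e u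
  Joins-incident (inj₁ (p , _)) = inj₁ p
  Joins-incident (inj₂ (_ , q)) = inj₂ q

  incident-joins : Incident e u → ∃ (Joins T e u)
  incident-joins (inj₁ refl) = _ , inj₁ (refl , refl)
  incident-joins (inj₂ refl) = _ , inj₂ (refl , refl)

  Joins-cases : Joins T e s t → Joins T e u w → (u ≡ s × w ≡ t) ⊎ (u ≡ t × w ≡ s)
  Joins-cases (inj₁ (refl , refl)) (inj₁ (refl , refl)) = inj₁ (refl , refl)
  Joins-cases (inj₁ (refl , refl)) (inj₂ (refl , refl)) = inj₂ (refl , refl)
  Joins-cases (inj₂ (refl , refl)) (inj₁ (refl , refl)) = inj₂ (refl , refl)
  Joins-cases (inj₂ (refl , refl)) (inj₂ (refl , refl)) = inj₁ (refl , refl)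

  infixr 5 _◅◅_

  _◅◅_ : Conn T K u w → Conn T K w v → Conn T K u v
  here            ◅◅ W′ = W′
  step e e∉ J W   ◅◅ W′ = step e e∉ J (W ◅◅ W′)

  hop : e ∉ K → Joins T e u w → Conn T K u w
  hop e∉ J = step _ e∉ J here

  reverse : Conn T K u v → Conn T K v u
  reverse here            = here
  reverse (step e e∉ J W) = reverse W ◅◅ hop e∉ (Joins-sym J)

  weaken : K′ ⊆ K → Conn T K u v → Conn T K′ u v
  weaken K′⊆K here            = here
  weaken K′⊆K (step e e∉ J W) = step e (e∉ ∘ K′⊆K) J (weaken K′⊆K W)

  ∉-∪-⁅⁆ : f ∉ K → f ≢ e → f ∉ K ∪ ⁅ e ⁆
  ∉-∪-⁅⁆ {K = K} {e = e} f∉K f≢e = [ f∉K , x≢y⇒x∉⁅y⁆ f≢e ] ∘ x∈p∪q⁻ K ⁅ e ⁆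

  first-step : Conn T K u v → u ≢ v → ∃₂ λ e w → e ∉ K × Joins T e u w
  first-step here            u≢v = ⊥-elim (u≢v refl)
  first-step (step e e∉ J _) _   = e , _ , e∉ , J

  avoid-unreachable : (∀ {s t} → Joins T e s t → ¬ Conn T (K ∪ ⁅ e ⁆) x s) →
                      Conn T K x y → Conn T (K ∪ ⁅ e ⁆) x y
  avoid-unreachable unreachable here = here
  avoid-unreachable {e = e} unreachable (step f f∉K J W) with f ≟ e
  ... | yes refl = ⊥-elim (unreachable J here)
  ... | no f≢e   =
    step f f∉ J (avoid-unreachable (λ Jₑ W′ → unreachable Jₑ (step f f∉ J W′)) W)
    where f∉ = ∉-∪-⁅⁆ f∉K f≢e

  enters-through : Joins T c v u → Conn T ⁅ c ⁆ v y → ¬ Conn T ⁅ c ⁆ v x →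
                   Conn T K x y → Conn T K x v
  enters-through J vy ¬vx here = ⊥-elim (¬vx vy)
  enters-through {c = c} J vy ¬vx (step f f∉K Jf W) with f ≟ c
  ... | yes refl with Joins-cases J Jf
  ...   | inj₁ (refl , _)    = ⊥-elim (¬vx here)
  ...   | inj₂ (refl , refl) = hop f∉K Jf
  enters-through J vy ¬vx (step f f∉K Jf W) | no f≢c =
    step f f∉K Jf (enters-through J vy (λ vw → ¬vx (vw ◅◅ hop (x≢y⇒x∉⁅y⁆ f≢c) (Joins-sym Jf))) W)

module Trees {n m k : ℕ} (T : LGraph n m k) (connected : Connected T) (acyclic : Acyclic T) where

  open Walks T

  private variable
    K : Subset m
    c e f : Fin m
    p q s t u v w x y : Fin n

  bridge : Joins T e s t → ¬ Conn T ⁅ e ⁆ s t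
  bridge {e} (inj₁ (refl , refl)) = acyclic e
  bridge {e} (inj₂ (refl , refl)) = acyclic e ∘ reverse

  side : Joins T c v u → ∀ x → Conn T ⁅ c ⁆ v x ⊎ Conn T ⁅ c ⁆ u x
  side {c} {v} {u} J x = go (connected x v)
    where
    go : Conn T K y v → Conn T ⁅ c ⁆ v y ⊎ Conn T ⁅ c ⁆ u y
    go here = inj₁ here
    go (step f _ Jf W) with f ≟ c
    ... | yes refl with Joins-cases J Jf
    ...   | inj₁ (refl , _) = inj₁ here
    ...   | inj₂ (refl , _) = inj₂ here
    go (step f _ Jf W) | no f≢c with go W
    ...   | inj₁ vw = inj₁ (vw ◅◅ hop (x≢y⇒x∉⁅y⁆ f≢c) (Joins-sym Jf))
    ...   | inj₂ uw = inj₂ (uw ◅◅ hop (x≢y⇒x∉⁅y⁆ f≢c) (Joins-sym Jf))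

  far-side : Joins T c v u → ¬ Conn T ⁅ c ⁆ v x → Conn T ⁅ c ⁆ u x
  far-side J ¬vx = [ ⊥-elim ∘ ¬vx , id ] (side J _)

  Conn-⁅⁆? : ∀ c x y → Dec (Conn T ⁅ c ⁆ x y)
  Conn-⁅⁆? c x y with side (ends-joined c) x | side (ends-joined c) y
  ... | inj₁ vx | inj₁ vy = yes (reverse vx ◅◅ vy)
  ... | inj₂ ux | inj₂ uy = yes (reverse ux ◅◅ uy)
  ... | inj₁ vx | inj₂ uy = no λ xy → bridge (ends-joined c) (vx ◅◅ xy ◅◅ reverse uy)
  ... | inj₂ ux | inj₁ vy = no λ xy → bridge (ends-joined c) (vy ◅◅ reverse xy ◅◅ reverse ux)

  -- The second component is what the induction needs after the walk crosses e.
  reroute : Joins T e p q → Conn T ⁅ e ⁆ p y → Conn T K x y →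
            (Conn T ⁅ e ⁆ p x → Conn T (K ∪ ⁅ e ⁆) x y) × (Conn T ⁅ e ⁆ q x → Conn T (K ∪ ⁅ e ⁆) p y)
  reroute J py here = (λ _ → here) , (λ qy → ⊥-elim (bridge J (py ◅◅ reverse qy)))
  reroute {e = e} J py (step f f∉K Jf W) with reroute J py W | f ≟ e
  ... | ihp , ihq | yes refl with Joins-cases J Jf
  ...   | inj₁ (refl , refl) = (λ _ → ihq here) , (λ qp → ⊥-elim (bridge J (reverse qp)))
  ...   | inj₂ (refl , refl) = (λ pq → ⊥-elim (bridge J pq)) , (λ _ → ihp here)
  reroute J py (step f f∉K Jf W) | ihp , ihq | no f≢e =
    (λ px → step f (∉-∪-⁅⁆ f∉K f≢e) Jf (ihp (px ◅◅ xw))) , (λ qx → ihq (qx ◅◅ xw))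
    where xw = hop (x≢y⇒x∉⁅y⁆ f≢e) Jf

  Conn-∪-⁅⁆ : Conn T K x y → Conn T ⁅ e ⁆ x y → Conn T (K ∪ ⁅ e ⁆) x y
  Conn-∪-⁅⁆ {y = y} {e = e} W xy with side (ends-joined e) y
  ... | inj₁ py = proj₁ (reroute (ends-joined e) py W) (py ◅◅ reverse xy)
  ... | inj₂ qy = proj₁ (reroute (Joins-sym (ends-joined e)) qy W) (qy ◅◅ reverse xy)

  ⁅⁆⊆ : e ∈ K → ⁅ e ⁆ ⊆ K
  ⁅⁆⊆ {e} {K} e∈K f∈⁅e⁆ = subst (_∈ K) (sym (x∈⁅y⁆⇒x≡y e f∈⁅e⁆)) e∈K

  Conn-from-⁅⁆ : ∀ K → (∀ {f} → f ∈ K → Conn T ⁅ f ⁆ x y) → Conn T K x y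
  Conn-from-⁅⁆ {x} {y} K = go K (⊂-wellFounded K)
    where
    go : ∀ K → Acc _⊂_ K → (∀ {f} → f ∈ K → Conn T ⁅ f ⁆ x y) → Conn T K x y
    go K (acc smaller) avoidable with nonempty? K
    ... | no empty = weaken (λ f∈K → ⊥-elim (empty (_ , f∈K))) (connected x y)
    ... | yes (e , e∈K) = weaken K⊆ (Conn-∪-⁅⁆ W (avoidable e∈K))
      where
      W : Conn T (K - e) x y
      W = go (K - e) (smaller (x∈p⇒p-x⊂p e∈K)) (λ f∈ → avoidable (p─q⊆p K ⁅ e ⁆ f∈))
      K⊆ : K ⊆ (K - e) ∪ ⁅ e ⁆
      K⊆ {f} f∈K with f ≟ e
      ... | yes refl = x∈p∪q⁺ (inj₂ (x∈⁅x⁆ f))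
      ... | no f≢e   = x∈p∪q⁺ (inj₁ (x∈p∧x≢y⇒x∈p-y f∈K f≢e))

  Conn? : ∀ K x y → Dec (Conn T K x y)
  Conn? K x y = map′ (λ avoidable → Conn-from-⁅⁆ K (avoidable _))
                     (λ W f f∈K → weaken (⁅⁆⊆ f∈K) W)
                     (all? λ f → f ∈? K →-dec Conn-⁅⁆? f x y)

  separating-edge : x ≢ y → ∃₂ λ d w → Joins T d x w × ¬ Conn T ⁅ d ⁆ x y
  separating-edge {x} {y} x≢y
    with any? (λ d → incident? T x d ×-dec ¬? (Conn-⁅⁆? d x y))
  ... | yes (d , inc , sep) = d , proj₁ (incident-joins inc) , proj₂ (incident-joins inc) , sep
  ... | no none with first-step (Conn-from-⁅⁆ (select (incident? T x)) avoidable) x≢y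
    -- otherwise some walk from x to y would avoid every edge at x
    where
    avoidable : ∀ {d} → d ∈ select (incident? T x) → Conn T ⁅ d ⁆ x y
    avoidable {d} d∈ = decidable-stable (Conn-⁅⁆? d x y) λ sep → none (d , ∈-select⁻ (incident? T x) d∈ , sep)
  ...   | _ , _ , d∉ , J = ⊥-elim (d∉ (∈-select⁺ (incident? T x) (Joins-incident J)))

  -- From v's side, neither end of f can be reached without crossing c.
  off-side : Joins T c v u → Joins T f s t → f ≢ c → Conn T ⁅ c ⁆ u s →
             Conn T ⁅ c ⁆ v x → Conn T ⁅ c ⁆ v y → Conn T ⁅ f ⁆ x y
  off-side {c = c} {u = u} {f = f} J Jf f≢c us vx vy =
    weaken (q⊆p∪q ⁅ c ⁆ ⁅ f ⁆) (avoid-unreachable unreachable (reverse vx ◅◅ vy))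
    where
    end-beyond : ∀ {s′ t′} → Joins T f s′ t′ → Conn T ⁅ c ⁆ u s′
    end-beyond Jf′ with Joins-cases Jf Jf′
    ... | inj₁ (refl , _) = us
    ... | inj₂ (refl , _) = us ◅◅ hop (x≢y⇒x∉⁅y⁆ f≢c) Jf
    unreachable : ∀ {s′ t′} → Joins T f s′ t′ → ¬ Conn T (⁅ c ⁆ ∪ ⁅ f ⁆) _ s′
    unreachable Jf′ xs′ = bridge J (vx ◅◅ weaken (p⊆p∪q ⁅ f ⁆) xs′ ◅◅ reverse (end-beyond Jf′))

module SplittingCores
  {n m k : ℕ} (T : LGraph n m k) (connected : Connected T) (acyclic : Acyclic T)
  (lab-injective : ∀ a b → lab T a ≡ lab T b → a ≡ b) (leaf : ∀ a → deg T (lab T a) ≤ 1)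
  {Colour : Set} (_≟ᶜ_ : DecidableEquality Colour) (col : Fin k → Colour)
  where

  open Walks T
  open Trees T connected acyclic

  private variable
    A : Subset k
    K K′ : Subset m
    P Q : Pred (Subset m) 0ℓ
    c d f : Fin m
    u v w x : Fin n
    a a′ b : Fin k
    α : Colour
    j : ℕ

  lab-distinct : a ≢ b → lab T a ≢ lab T b
  lab-distinct a≢b = a≢b ∘ lab-injective _ _

  pendant-unique : Incident d (lab T a) → Incident c (lab T a) → d ≡ c
  pendant-unique {d} {a} {c} d-inc c-inc =
    ∈-length≤1 (leaf a) (∈-filter⁺ (incident? T (lab T a)) (∈-allFin d) d-inc)
                        (∈-filter⁺ (incident? T (lab T a)) (∈-allFin c) c-inc)

  beyond-pendant : Joins T c (lab T a) w → x ≢ lab T a → ¬ Conn T ⁅ c ⁆ (lab T a) x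
  beyond-pendant J x≢a W with first-step W (x≢a ∘ sym)
  ... | d , _ , d∉ , Jd = x∉⁅y⁆⇒x≢y d∉ (pendant-unique (Joins-incident Jd) (Joins-incident J))

  Near : Fin m → Fin n → Fin k → Set
  Near c v a = Conn T ⁅ c ⁆ v (lab T a)

  Near? : ∀ c v a → Dec (Near c v a)
  Near? c v a = Conn-⁅⁆? c v (lab T a)

  near far : Subset k → Fin m → Fin n → Subset k
  near A c v = A ∩ select (Near? c v)
  far  A c v = A ∩ select (λ a → ¬? (Near? c v a))

  near⁺ : a ∈ A → Near c v a → a ∈ near A c v
  near⁺ a∈A na = x∈p∩q⁺ (a∈A , ∈-select⁺ (Near? _ _) na)

  near⁻ : a ∈ near A c v → a ∈ A × Near c v a
  near⁻ {A = A} a∈ = Product.map₂ (∈-select⁻ (Near? _ _)) (x∈p∩q⁻ A _ a∈)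

  far⁺ : a ∈ A → ¬ Near c v a → a ∈ far A c v
  far⁺ a∈A fa = x∈p∩q⁺ (a∈A , ∈-select⁺ (λ a → ¬? (Near? _ _ a)) fa)

  far⁻ : a ∈ far A c v → a ∈ A × ¬ Near c v a
  far⁻ {A = A} a∈ = Product.map₂ (∈-select⁻ (λ a → ¬? (Near? _ _ a))) (x∈p∩q⁻ A _ a∈)

  SplitsOn : Subset k → Subset m → Set
  SplitsOn A K = ∀ {a b} → a ∈ A → b ∈ A → col a ≢ col b → ¬ LConn T K a b

  RefinesOn : Subset k → Subset m → Subset m → Set
  RefinesOn A K K′ = ∀ {a b} → a ∈ A → b ∈ A → LConn T K a b → LConn T K′ a b

  InSpan : Subset k → Fin m → Set
  InSpan A e = ∃₂ λ a b → a ∈ A × b ∈ A × ¬ LConn T ⁅ e ⁆ a b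

  Bicoloured : Subset k → Set
  Bicoloured A = ∃₂ λ a b → a ∈ A × b ∈ A × col a ≢ col b

  Bicoloured? : ∀ A → Dec (Bicoloured A)
  Bicoloured? A = any? λ a → any? λ b → a ∈? A ×-dec b ∈? A ×-dec ¬? (col a ≟ᶜ col b)

  monochromatic : ¬ Bicoloured A → a ∈ A → b ∈ A → col a ≡ col b
  monochromatic ¬bicoloured a∈A b∈A =
    decidable-stable (col _ ≟ᶜ col _) λ a≢b → ¬bicoloured (_ , _ , a∈A , b∈A , a≢b)

  -- A core for the labels in A that only has to cover the splitting cuts in Covered;
  -- weight says Σ 2^-|K| ≤ 2^-j.
  record Core (A : Subset k) (Covered : Pred (Subset m) 0ℓ) (j : ℕ) : Set where
    field
      cuts     : List (Subset m)
      nonempty : All Nonempty cuts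
      spanned  : All (Lift (InSpan A)) cuts
      covers   : ∀ {K} → SplitsOn A K → Covered K → ∃[ K′ ] K′ ∈ₗ cuts × RefinesOn A K K′
      weight   : 2 ^ j * scaledWeight cuts ≤ 2 ^ m

  merge : Core A P (suc j) → Core A Q (suc j) → Core A (P ∪ᵘ Q) j
  merge {j = j} C C′ = record
    { cuts     = C.cuts ++ C′.cuts
    ; nonempty = All.++⁺ C.nonempty C′.nonempty
    ; spanned  = All.++⁺ C.spanned C′.spanned
    ; covers   = λ where
        splits (inj₁ p) → let K′ , K′∈ , refines = C.covers splits p in K′ , ∈-++⁺ˡ K′∈ , refines
        splits (inj₂ q) → let K′ , K′∈ , refines = C′.covers splits q in K′ , ∈-++⁺ʳ C.cuts K′∈ , refines
    ; weight   = begin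
        2 ^ j * scaledWeight (C.cuts ++ C′.cuts) ≡⟨ cong (2 ^ j *_) (scaledWeight-++ C.cuts C′.cuts) ⟩
        2 ^ j * (W + W′)                         ≡⟨ *-distribˡ-+ (2 ^ j) W W′ ⟩
        2 ^ j * W + 2 ^ j * W′
          ≤⟨ +-≤-halves {2 ^ j * W} {2 ^ j * W′} (halve C.weight) (halve C′.weight) ⟩
        2 ^ m                                    ∎
    }
    where
    module C = Core C
    module C′ = Core C′
    open ≤-Reasoning
    W = scaledWeight C.cuts
    W′ = scaledWeight C′.cuts
    halve : ∀ {w} → 2 ^ suc j * w ≤ 2 ^ m → 2 * (2 ^ j * w) ≤ 2 ^ m
    halve {w} = subst (_≤ 2 ^ m) (*-assoc 2 (2 ^ j) w)

  cover-all : (∀ {K} → SplitsOn A K → P K) → Core A P j → Core A U j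
  cover-all covered C = record
    { cuts = cuts ; nonempty = nonempty ; spanned = spanned ; weight = weight
    ; covers = λ splits _ → covers splits (covered splits) }
    where open Core C

  record Branch (A : Subset k) (v : Fin n) (α : Colour) : Set where
    field
      edge       : Fin m
      end        : Fin n
      joins      : Joins T edge v end
      rep        : Fin k
      rep-far    : rep ∈ far A edge v
      far-colour : ∀ {a} → a ∈ far A edge v → col a ≡ α

  Isolated : Branch A v α → Subset m → Set
  Isolated {A} {v} B K = ∀ {a} → a ∈ far A (Branch.edge B) v → ¬ Conn T K (lab T a) v

  module BranchFacts {A v α} (B : Branch A v α) {y} (y∈A : y ∈ A) (y≢α : col y ≢ α) where

    open Branch B

    y-near : y ∈ near A edge v
    y-near = near⁺ y∈A (decidable-stable (Near? edge v y) λ fy → y≢α (far-colour (far⁺ y∈A fy)))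

    near⊂A : near A edge v ⊂ A
    near⊂A = p∩q⊆p A _ , rep , proj₁ (far⁻ rep-far) , λ rep∈ → proj₂ (far⁻ rep-far) (proj₂ (near⁻ rep∈))

    edge-in-span : InSpan A edge
    edge-in-span = rep , y , proj₁ (far⁻ rep-far) , y∈A ,
                   λ W → proj₂ (far⁻ rep-far) (proj₂ (near⁻ y-near) ◅◅ reverse W)

    edge-∉ : Lift (InSpan (near A edge v)) K → edge ∉ K
    edge-∉ spanned edge∈K with spanned edge∈K
    ... | _ , _ , a∈ , b∈ , sep = sep (reverse (proj₂ (near⁻ a∈)) ◅◅ proj₂ (near⁻ b∈))

    lift-span : Lift (InSpan (near A edge v)) K → Lift (InSpan A) (K ∪ ⁅ edge ⁆)
    lift-span {K} spanned e∈ with x∈p∪q⁻ K ⁅ edge ⁆ e∈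
    ... | inj₁ e∈K  = let a , b , a∈ , b∈ , sep = spanned e∈K in
                      a , b , proj₁ (near⁻ a∈) , proj₁ (near⁻ b∈) , sep
    ... | inj₂ e∈⁅⁆ = subst (InSpan A) (sym (x∈⁅y⁆⇒x≡y edge e∈⁅⁆)) edge-in-span

    refine-lift : Isolated B K → RefinesOn (near A edge v) K K′ → Lift (InSpan (near A edge v)) K′ →
                  RefinesOn A K (K′ ∪ ⁅ edge ⁆)
    refine-lift {K} {K′} isolated refines spanned {a} {b} a∈ b∈ W with Near? edge v a | Near? edge v b
    ... | yes na | yes nb = Conn-∪-⁅⁆ (refines (near⁺ a∈ na) (near⁺ b∈ nb) W) (reverse na ◅◅ nb)
    ... | no fa  | yes nb = ⊥-elim (isolated (far⁺ a∈ fa) (enters-through joins nb fa W))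
    ... | yes na | no fb  = ⊥-elim (isolated (far⁺ b∈ fb) (enters-through joins na fb (reverse W)))
    ... | no fa  | no fb  = Conn-from-⁅⁆ (K′ ∪ ⁅ edge ⁆) avoidable
      where
      ua : Conn T ⁅ edge ⁆ end (lab T a)
      ua = far-side joins fa
      ub : Conn T ⁅ edge ⁆ end (lab T b)
      ub = far-side joins fb
      ≢edge : f ∈ K′ → f ≢ edge
      ≢edge f∈K′ refl = edge-∉ spanned f∈K′
      -- Each f ∈ K′ separates two labels near v, so its ends lie on v's side of edge.
      avoidable-in-K′ : f ∈ K′ → Conn T ⁅ f ⁆ (lab T a) (lab T b)
      avoidable-in-K′ {f} f∈K′ with side joins (proj₁ (ends T f))
      ... | inj₁ vs = off-side (Joins-sym joins) (ends-joined f) (≢edge f∈K′) vs ua ub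
      ... | inj₂ us = let _ , _ , p∈ , q∈ , sep = spanned f∈K′ in
        ⊥-elim (sep (off-side joins (ends-joined f) (≢edge f∈K′) us (proj₂ (near⁻ p∈)) (proj₂ (near⁻ q∈))))
      avoidable : f ∈ K′ ∪ ⁅ edge ⁆ → Conn T ⁅ f ⁆ (lab T a) (lab T b)
      avoidable {f} f∈ with x∈p∪q⁻ K′ ⁅ edge ⁆ f∈
      ... | inj₁ f∈K′     = avoidable-in-K′ f∈K′
      ... | inj₂ f∈⁅edge⁆ = subst (λ g → Conn T ⁅ g ⁆ (lab T a) (lab T b)) (sym (x∈⁅y⁆⇒x≡y edge f∈⁅edge⁆))
                                  (reverse ua ◅◅ ub)

    lift : Core (near A edge v) U j → Core A (Isolated B) (suc j)
    lift {j} C = record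
      { cuts     = map (_∪ ⁅ edge ⁆) C.cuts
      ; nonempty = All.map⁺ (All.universal (λ _ → edge , x∈p∪q⁺ (inj₂ (x∈⁅x⁆ edge))) C.cuts)
      ; spanned  = All.map⁺ (All.map lift-span C.spanned)
      ; covers   = λ splits isolated →
          let K′ , K′∈ , refines = C.covers (λ a∈ b∈ → splits (near⊆A a∈) (near⊆A b∈)) _ in
          K′ ∪ ⁅ edge ⁆ , ∈-map⁺ _ K′∈ , refine-lift isolated refines (All.lookup C.spanned K′∈)
      ; weight   = begin
          2 ^ suc j * W↑               ≡⟨ cong (_* W↑) (*-comm 2 (2 ^ j)) ⟩
          2 ^ j * 2 * W↑               ≡⟨ *-assoc (2 ^ j) 2 W↑ ⟩
          2 ^ j * (2 * W↑)             ≤⟨ *-monoʳ-≤ (2 ^ j) (scaledWeight-∪-fresh (All.map edge-∉ C.spanned)) ⟩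
          2 ^ j * scaledWeight C.cuts  ≤⟨ C.weight ⟩
          2 ^ m                        ∎
      }
      where
      module C = Core C
      open ≤-Reasoning
      W↑ = scaledWeight (map (_∪ ⁅ edge ⁆) C.cuts)
      near⊆A = p∩q⊆p A (select (Near? edge v))

    single-cut-core : (∀ {a} → a ∈ near A edge v → col a ≡ col y) → Core A U 1
    single-cut-core near-colour = record
      { cuts     = ⁅ edge ⁆ ∷ []
      ; nonempty = (edge , x∈⁅x⁆ edge) ∷ []
      ; spanned  = (λ e∈ → subst (InSpan A) (sym (x∈⁅y⁆⇒x≡y edge e∈)) edge-in-span) ∷ []
      ; covers   = λ splits _ → ⁅ edge ⁆ , here refl , λ a∈ b∈ W →
          same-colour⇒joined a∈ b∈ (decidable-stable (col _ ≟ᶜ col _) λ a≢b → splits a∈ b∈ a≢b W)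
      ; weight   = ≤-reflexive (scaledWeight-⁅⁆ edge)
      }
      where
      mixed : a ∈ A → b ∈ A → Near edge v a → ¬ Near edge v b → col a ≢ col b
      mixed a∈ b∈ na fb eq = y≢α (trans (sym (near-colour (near⁺ a∈ na))) (trans eq (far-colour (far⁺ b∈ fb))))
      same-colour⇒joined : a ∈ A → b ∈ A → col a ≡ col b → LConn T ⁅ edge ⁆ a b
      same-colour⇒joined {a} {b} a∈ b∈ eq with Near? edge v a | Near? edge v b
      ... | yes na | yes nb = reverse na ◅◅ nb
      ... | no fa  | no fb  = reverse (far-side joins fa) ◅◅ far-side joins fb
      ... | yes na | no fb  = ⊥-elim (mixed a∈ b∈ na fb eq)
      ... | no fa  | yes nb = ⊥-elim (mixed b∈ a∈ nb fa (sym eq))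

  record Fork (A : Subset k) : Set where
    field
      hub               : Fin n
      colourˡ colourʳ   : Colour
      colourˡ≢colourʳ   : colourˡ ≢ colourʳ
      left              : Branch A hub colourˡ
      right             : Branch A hub colourʳ

  module ForkFacts {A} (F : Fork A) where

    open Fork F
    open Branch using (edge; rep-far; far-colour)

    module Left  = BranchFacts left (proj₁ (far⁻ (rep-far right)))
                     (λ eq → colourˡ≢colourʳ (trans (sym eq) (far-colour right (rep-far right))))
    module Right = BranchFacts right (proj₁ (far⁻ (rep-far left)))
                     (λ eq → colourˡ≢colourʳ (trans (sym (far-colour left (rep-far left))) eq))

    -- Labels behind the two branches have different colours, so at most one side reaches the hub.
    isolated-or : SplitsOn A K → Isolated left K ⊎ Isolated right K
    isolated-or {K} splits with any? (λ x → x ∈? far A (edge left) hub ×-dec Conn? K (lab T x) hub)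
    ... | no none = inj₁ λ a∈ W → none (_ , a∈ , W)
    ... | yes (x , x∈ , Wx) = inj₂ λ a∈ Wa →
      splits (proj₁ (far⁻ x∈)) (proj₁ (far⁻ a∈))
             (λ eq → colourˡ≢colourʳ (trans (sym (far-colour left x∈)) (trans eq (far-colour right a∈))))
             (Wx ◅◅ reverse Wa)

    core-of-fork : (∀ {A′} → A′ ⊂ A → Bicoloured A′ → Core A′ U 1) → Core A U 1
    core-of-fork core′ with Bicoloured? (near A (edge left) hub) | Bicoloured? (near A (edge right) hub)
    ... | yes bicolouredˡ | yes bicolouredʳ =
      cover-all isolated-or (merge (Left.lift (core′ Left.near⊂A bicolouredˡ))
                                   (Right.lift (core′ Right.near⊂A bicolouredʳ)))
    ... | no monoˡ | _ = Left.single-cut-core λ a∈ → monochromatic monoˡ a∈ Left.y-near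
    ... | _ | no monoʳ = Right.single-cut-core λ a∈ → monochromatic monoʳ a∈ Right.y-near

  Beyond? : ∀ c v w → Dec (¬ Conn T ⁅ c ⁆ v w)
  Beyond? c v w = ¬? (Conn-⁅⁆? c v w)

  beyond : Fin m → Fin n → Subset n
  beyond c v = select (Beyond? c v)

  beyond-shrinks : Joins T c v u → Joins T d u w → d ≢ c → beyond d u ⊂ beyond c v
  beyond-shrinks {c} {v} {u} {d} J Jd d≢c =
    (λ x∈ → ∈-select⁺ (Beyond? c v) (∈-select⁻ (Beyond? d u) x∈ ∘ nested)) ,
    u , ∈-select⁺ (Beyond? c v) (bridge J) , λ u∈ → ∈-select⁻ (Beyond? d u) u∈ here
    where
    nested : Conn T ⁅ c ⁆ v x → Conn T ⁅ d ⁆ u x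
    nested vx = hop (x≢y⇒x∉⁅y⁆ (d≢c ∘ sym)) (Joins-sym J) ◅◅ off-side J Jd d≢c here here vx

  far-end-≢-label : Joins T c v u → ¬ Near c v a → ¬ Near c v b → a ≢ b → u ≢ lab T a
  far-end-≢-label J fa fb a≢b refl = beyond-pendant (Joins-sym J) (lab-distinct (a≢b ∘ sym)) (far-side J fb)

  fork-at : Joins T c v u → Bicoloured (far A c v) →
            ¬ (∃ λ d → Incident d u × d ≢ c × Bicoloured (far A d u)) → Fork A
  fork-at {c} {v} {u} {A} J (a , b , a∈ , b∈ , a≢b) stuck = record
    { colourˡ≢colourʳ = a≢b
    ; left            = branch-to a∈ b∈ a≢b
    ; right           = branch-to b∈ a∈ (a≢b ∘ sym)
    }
    where
    branch-to : ∀ {x y} → x ∈ far A c v → y ∈ far A c v → col x ≢ col y → Branch A u (col x)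
    branch-to {x} x∈ y∈ x≢y
      with separating-edge (far-end-≢-label J (proj₂ (far⁻ x∈)) (proj₂ (far⁻ y∈)) (x≢y ∘ cong col))
    ... | d , w , Jd , sep = record
      { edge = d ; end = w ; joins = Jd ; rep = x ; rep-far = far⁺ (proj₁ (far⁻ x∈)) sep
      ; far-colour = λ a′∈ → monochromatic (λ bc → stuck (d , Joins-incident Jd , d≢c , bc))
                                           a′∈ (far⁺ (proj₁ (far⁻ x∈)) sep)
      }
      where
      d≢c : d ≢ c
      d≢c refl = sep (far-side J (proj₂ (far⁻ x∈)))

  -- Step across edges behind which A stays bicoloured; the vertices behind shrink.
  find-fork : Joins T c v u → Bicoloured (far A c v) → Fork A
  find-fork J bicoloured = go J bicoloured (⊂-wellFounded _)
    where
    go : Joins T c v u → Bicoloured (far A c v) → Acc _⊂_ (beyond c v) → Fork A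
    go {c} {v} {u} {A} J bicoloured (acc smaller)
      with any? (λ d → incident? T u d ×-dec ¬? (d ≟ c) ×-dec Bicoloured? (far A d u))
    ... | no stuck = fork-at J bicoloured stuck
    ... | yes (d , inc , d≢c , bicoloured′) =
      let _ , Jd = incident-joins inc in
      go Jd bicoloured′ (smaller (beyond-shrinks J Jd d≢c))

  pendant-branch : Joins T c (lab T a) w → a ∈ A → Branch A w (col a)
  pendant-branch {c} {a} {w} {A} J a∈ = record
    { edge = c ; end = lab T a ; joins = Joins-sym J ; rep = a
    ; rep-far = far⁺ a∈ (bridge (Joins-sym J))
    ; far-colour = λ a′∈ → cong col (only-a a′∈)
    }
    where
    only-a : a′ ∈ far A c w → a′ ≡ a
    only-a {a′} a′∈ = decidable-stable (a′ ≟ a) λ a′≢a →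
      [ proj₂ (far⁻ a′∈) , beyond-pendant J (lab-distinct a′≢a) ] (side (Joins-sym J) (lab T a′))

  core : ∀ A → Acc _⊂_ A → Bicoloured A → Core A U 1
  core A (acc smaller) (a , b , a∈ , b∈ , a≢b) with separating-edge (lab-distinct (a≢b ∘ cong col))
  -- c is the pendant edge of the leaf a
  ... | c , w , J , _ with Bicoloured? (far A c (lab T a))
  ...   | yes bicoloured = ForkFacts.core-of-fork (find-fork J bicoloured) λ A′⊂A → core _ (smaller A′⊂A)
  ...   | no mono = BranchFacts.single-cut-core (pendant-branch J a∈) b∈ (a≢b ∘ sym) near-colour
    where
    near-colour : a′ ∈ near A c w → col a′ ≡ col b
    near-colour a′∈ =
      monochromatic mono (far⁺ (proj₁ (near⁻ a′∈)) λ aa′ → bridge J (aa′ ◅◅ reverse (proj₂ (near⁻ a′∈))))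
                         (far⁺ b∈ (beyond-pendant J (lab-distinct (a≢b ∘ cong col ∘ sym))))

splitting-core : ∀ {n m k} (T : LGraph n m k) → IsTree T → LeavesBijLabelled T →
                 (Y : Subset k) → Nonempty Y → Nonempty (∁ Y) →
                 Σ (List (Subset m)) (λ C → IsSplittingCore T Y C × 2 * scaledWeight C ≤ 2 ^ m)
splitting-core {m = m} T (connected , acyclic) (lab-injective , leaves) Y (y , y∈Y) (z , z∈∁Y) =
  deduplicate _≟ˢ_ cuts ,
  (deduplicate-! _≟ˢ_ cuts , All.deduplicate⁺ _≟ˢ_ nonempty , covers′) ,
  ≤-trans (*-monoʳ-≤ 2 (scaledWeight-⊑ (deduplicate-⊑ _≟ˢ_ cuts))) weight
  where
  _≟ˢ_ : DecidableEquality (Subset m)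
  _≟ˢ_ = ≡-dec Bool._≟_
  leaf : ∀ a → deg T (lab T a) ≤ 1
  leaf a = Equivalence.to (leaves (lab T a)) (a , refl)
  open SplittingCores T connected acyclic lab-injective leaf Bool._≟_ (λ a → does (a ∈? Y))
  y≢z : does (y ∈? Y) ≢ does (z ∈? Y)
  y≢z rewrite dec-true (y ∈? Y) y∈Y | dec-false (z ∈? Y) (x∈∁p⇒x∉p z∈∁Y) = λ ()
  open Core (core ⊤ (⊂-wellFounded ⊤) (y , z , ∈⊤ , ∈⊤ , y≢z))
  splits-on-⊤ : ∀ {K} → Splits T Y K → SplitsOn ⊤ K
  splits-on-⊤ splits {a} {b} _ _ a≢b W with a ∈? Y | b ∈? Y
  ... | yes a∈Y | no b∉Y  = splits a b a∈Y b∉Y W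
  ... | no a∉Y  | yes b∈Y = splits b a b∈Y a∉Y (Walks.reverse T W)
  ... | yes _   | yes _   = a≢b refl
  ... | no _    | no _    = a≢b refl
  covers′ : ∀ K → Splits T Y K → Any (Refines T K) (deduplicate _≟ˢ_ cuts)
  covers′ K splits = let K′ , K′∈ , refines = covers (splits-on-⊤ splits) _ in
                     lose (∈-deduplicate⁺ _≟ˢ_ K′∈) λ a b → refines ∈⊤ ∈⊤

binary-phylo-tree : ∀ {n m k} {T : LGraph n m k} → IsBinaryPhyloTree T → IsTree T × LeavesBijLabelled T
binary-phylo-tree (inj₁ (tree , labelling , _)) = tree , labelling
binary-phylo-tree (inj₂ (tree , labelling , _)) = tree , labelling

lemma1 : (n m k : ℕ) (T : LGraph n m k) → IsBinaryPhyloTree T →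
    (Y : Subset k) → Nonempty Y → Nonempty (∁ Y) →
    Σ (List (Subset m)) (λ C → IsSplittingCore T Y C × 2 * scaledWeight C ≤ 2 ^ m)
lemma1 n m k T phylo = splitting-core T (proj₁ (binary-phylo-tree phylo)) (proj₂ (binary-phylo-tree phylo))
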